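{- Let $k$ be a nonnegative integer. Then $B_k+k<0$ if and only if $k\ge 20$ and $4$ divides $k$.
   Context: Bernoulli polynomials are defined by $\frac{te^{xt}}{e^t-1}=\sum_{k\ge0}\frac{B_k(x)}{k!}t^k$, and the Bernoulli numbers are $B_k:=B_k(1)$ (so $B_0=1$, $B_1=1/2$, $B_2=1/6$, $B_4=-1/30$, $B_{20}=-174611/330$). -}

module Defs where

open import Data.Nat as ℕ using (ℕ; zero; suc)
open import Data.Nat.Combinatorics using (_C_)
open import Data.Integer using (+_)
open import Data.Rational using (ℚ; _+_; _-_; _*_; _/_; 0ℚ; 1ℚ)
open import Data.Fin using (Fin; toℕ; fromℕ)
open import Data.Vec using (Vec; []; _∷_; _∷ʳ_; lookup; tabulate; foldr)

ℕtoℚ : ℕ → ℚ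
ℕtoℚ n = + n / 1

sumℚ : ∀ {n} → Vec ℚ n → ℚ
sumℚ = foldr _ _+_ 0ℚ

-- bernoulliVec n = [B_0, ..., B_n], with the convention B_k = B_k(1)
-- (so B_1 = 1/2), computed by the recurrence obtained from the
-- generating function t e^t/(e^t - 1) = t/(1 - e^{-t}):
--   Σ_{j=0}^{m} C(m+1, j) B_j = m + 1   for all m ≥ 0.
-- Solving for B_{n+1} (m = n+1):
--   B_{n+1} = (n + 2 - Σ_{j=0}^{n} C(n+2, j) B_j) / (n + 2).
bernoulliVec : (n : ℕ) → Vec ℚ (suc n)
bernoulliVec zero = 1ℚ ∷ []
bernoulliVec (suc n) = v ∷ʳ b
  where
  v : Vec ℚ (suc n)
  v = bernoulliVec n
  s : ℚ
  s = sumℚ (tabulate (λ (j : Fin (suc n)) → ℕtoℚ (suc (suc n) C toℕ j) * lookup v j))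
  b : ℚ
  b = (+ 1 / suc (suc n)) * (ℕtoℚ (suc (suc n)) - s)

bernoulli : ℕ → ℚ
bernoulli k = lookup (bernoulliVec k) (fromℕ k)

-- Write B(t) = t eᵗ/(eᵗ − 1) = Σ Bₙ tⁿ/n!. The recurrence defining Bₙ says B(t)(eᵗ − 1) = t eᵗ;
-- differentiating and cancelling eᵗ − 1 gives t B′ = B + t B − B², so F = B − 1 − t/2
-- satisfies t F′ + F + F² = t²/4, i.e. (n + 1) Fₙ = [n = 2]/2 − Σⱼ C(n, j) Fⱼ Fₙ₋ⱼ.
-- Induction on n shows that Fₙ = 0 for odd n, and then that the coefficients Hₙ = (−1)^(n/2+1) Fₙ
-- of −F(it) satisfy (n + 1) Hₙ = [n = 2]/2 + Σⱼ C(n, j) Hⱼ Hₙ₋ⱼ, so Hₙ ≥ 0. Hence Bₖ ≥ 0 unless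
-- 4 ∣ k, and then Bₖ = −Hₖ. Keeping only the term j = 2 (H₂ = 1/6) gives
-- (n + 3) Hₙ₊₂ ≥ C(n + 2, 2) Hₙ / 6, enough to carry Hₙ > n from n = 20 (H₂₀ = 174611/330)
-- to all larger even n; the multiples of 4 below 20 are checked by computation.
module Submission where

open import Algebra.Bundles using (CommutativeRing)
import Algebra.Construct.Pointwise as Pointwise
import Algebra.Properties.Ring as RingProperties
import Algebra.Solver.Ring
open import Algebra.Solver.Ring.AlmostCommutativeRing
  using (fromCommutativeRing; _-Raw-AlmostCommutative⟶_)
open import Data.Empty using (⊥-elim)
open import Data.Fin as Fin using (Fin; toℕ; fromℕ; inject₁; punchIn)
open import Data.Fin.Properties using (toℕ-fromℕ; toℕ-inject₁; toℕ<n)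
open import Data.Fin.Relation.Unary.Top using (view; ‵fromℕ; ‵inject₁)
open import Data.Integer as ℤ using (_◃_)
import Data.Integer.Properties as ℤ
open import Data.Maybe as Maybe using (Maybe)
open import Data.Nat as ℕ using (ℕ; zero; suc; _∸_; z≤n; s≤s; parity)
open import Data.Nat.Combinatorics
  using (_C_; nCk+nC[k+1]≡[n+1]C[k+1]; k>n⇒nCk≡0; nCn≡1; nC1≡n; nCk≡nC[n∸k])
open import Data.Nat.Coprimality using (1-coprimeTo) renaming (sym to coprime-sym)
open import Data.Nat.Divisibility using (_∣_; _∣?_; divides)
open import Data.Nat.Induction using (<-rec)
import Data.Nat.Properties as ℕ
open import Data.Nat.Solver using () renaming (module +-*-Solver to ℕ-Solver)
open import Data.Parity as ℙ using (0ℙ; 1ℙ)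
import Data.Parity.Properties as ℙ
open import Data.Product using (_×_; _,_)
open import Data.Rational as ℚ
  using (ℚ; 0ℚ; 1ℚ; ½; _+_; _*_; -_; _-_; _/_; _≤_; _<_; mkℚ; Positive; NonNegative)
import Data.Rational.Properties as ℚ
open import Data.Rational.Solver using (module +-*-Solver)
import Data.Sign as Sign
open import Data.Sum using (_⊎_; inj₁; inj₂)
open import Data.Unit using (tt)
open import Data.Vec using (Vec; []; _∷_; _∷ʳ_; lookup; tabulate)
open import Function.Base using (_∘_)
open import Function.Bundles using (_⇔_; mk⇔)
open import Level using (0ℓ)
open import Relation.Binary.PropositionalEquality
open import Relation.Nullary using (¬_; yes; no)
open import Relation.Nullary.Decidable using (dec⇒maybe; toWitness)

open import Algebra.Properties.Semiring.Sum (CommutativeRing.semiring ℚ.+-*-commutativeRing)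
  using (sum-syntax; sum⁺-syntax; sum-cong-≗; ∑-distrib-+; sum-init-last; sum-replicate-zero;
         sum-remove; *-distribˡ-sum)
open RingProperties ℚ.+-*-ring using (-‿involutive; -1*x≈-x)

open import Defs

private
  integer : ℕ → ℚ
  integer n = mkℚ (ℤ.+ n) 0 (coprime-sym (1-coprimeTo n))

  ℕtoℚ≡integer : ∀ n → ℕtoℚ n ≡ integer n
  ℕtoℚ≡integer n = ℚ.normalize-coprime _

ℕtoℚ-homo-+ : ∀ m n → ℕtoℚ (m ℕ.+ n) ≡ ℕtoℚ m + ℕtoℚ n
ℕtoℚ-homo-+ m n = begin
  ℤ.+ (m ℕ.+ n) / 1                                   ≡⟨ cong (_/ 1) (cong₂ ℤ._+_ (+◃-*1 m) (+◃-*1 n)) ⟨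
  ((Sign.+ ◃ (m ℕ.* 1)) ℤ.+ (Sign.+ ◃ (n ℕ.* 1))) / 1 ≡⟨⟩
  integer m + integer n                               ≡⟨ cong₂ _+_ (ℕtoℚ≡integer m) (ℕtoℚ≡integer n) ⟨
  ℕtoℚ m + ℕtoℚ n                                     ∎
  where
  open ≡-Reasoning
  +◃-*1 : ∀ k → Sign.+ ◃ (k ℕ.* 1) ≡ ℤ.+ k
  +◃-*1 k = trans (cong (Sign.+ ◃_) (ℕ.*-identityʳ k)) (ℤ.+◃n≡+n k)

ℕtoℚ-homo-* : ∀ m n → ℕtoℚ (m ℕ.* n) ≡ ℕtoℚ m * ℕtoℚ n
ℕtoℚ-homo-* m n = begin
  ℤ.+ (m ℕ.* n) / 1         ≡⟨ cong (_/ 1) (ℤ.+◃n≡+n (m ℕ.* n)) ⟨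
  (Sign.+ ◃ (m ℕ.* n)) / 1  ≡⟨⟩
  integer m * integer n     ≡⟨ cong₂ _*_ (ℕtoℚ≡integer m) (ℕtoℚ≡integer n) ⟨
  ℕtoℚ m * ℕtoℚ n           ∎
  where open ≡-Reasoning

ℕtoℚ-inverseʳ : ∀ n → ℕtoℚ (suc n) * (ℤ.+ 1 / suc n) ≡ 1ℚ
ℕtoℚ-inverseʳ n = begin
  ℕtoℚ (suc n) * (ℤ.+ 1 / suc n)          ≡⟨ cong₂ _*_ (ℕtoℚ≡integer (suc n))
                                                       (ℚ.normalize-coprime (1-coprimeTo (suc n))) ⟩
  integer (suc n) * ℚ.1/ integer (suc n)  ≡⟨ ℚ.*-inverseʳ (integer (suc n)) ⟩
  1ℚ                                      ∎
  where open ≡-Reasoning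

ℕtoℚ-nonNeg : ∀ n → NonNegative (ℕtoℚ n)
ℕtoℚ-nonNeg n = subst NonNegative (sym (ℕtoℚ≡integer n)) _

ℕtoℚ-pos : ∀ n → Positive (ℕtoℚ (suc n))
ℕtoℚ-pos n = subst Positive (sym (ℕtoℚ≡integer (suc n))) _

ℕtoℚ-mono-≤ : ∀ {m n} → m ℕ.≤ n → ℕtoℚ m ≤ ℕtoℚ n
ℕtoℚ-mono-≤ {m} {n} m≤n = begin
  ℕtoℚ m                  ≡⟨ ℚ.+-identityʳ (ℕtoℚ m) ⟨
  ℕtoℚ m + 0ℚ             ≤⟨ ℚ.+-monoʳ-≤ (ℕtoℚ m) (ℚ.nonNegative⁻¹ _ {{ℕtoℚ-nonNeg (n ∸ m)}}) ⟩
  ℕtoℚ m + ℕtoℚ (n ∸ m)   ≡⟨ ℕtoℚ-homo-+ m (n ∸ m) ⟨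
  ℕtoℚ (m ℕ.+ (n ∸ m))    ≡⟨ cong ℕtoℚ (ℕ.m+[n∸m]≡n m≤n) ⟩
  ℕtoℚ n                  ∎
  where open ℚ.≤-Reasoning

ℕtoℚ-mono-< : ∀ {m n} → m ℕ.< n → ℕtoℚ m < ℕtoℚ n
ℕtoℚ-mono-< {m} {n} m<n = begin-strict
  ℕtoℚ m          ≡⟨ ℚ.+-identityˡ (ℕtoℚ m) ⟨
  0ℚ + ℕtoℚ m     <⟨ ℚ.+-monoˡ-< (ℕtoℚ m) (ℚ.positive⁻¹ 1ℚ) ⟩
  1ℚ + ℕtoℚ m     ≡⟨ ℕtoℚ-homo-+ 1 m ⟨
  ℕtoℚ (suc m)    ≤⟨ ℕtoℚ-mono-≤ m<n ⟩
  ℕtoℚ n          ∎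
  where open ℚ.≤-Reasoning

pos*p≡0⇒p≡0 : ∀ r .{{_ : Positive r}} {p} → r * p ≡ 0ℚ → p ≡ 0ℚ
pos*p≡0⇒p≡0 r {p} rp≡0 = ℚ.≤-antisym
  (ℚ.*-cancelˡ-≤-pos r (ℚ.≤-reflexive (trans rp≡0 (sym (ℚ.*-zeroʳ r)))))
  (ℚ.*-cancelˡ-≤-pos r (ℚ.≤-reflexive (trans (ℚ.*-zeroʳ r) (sym rp≡0))))

*-nonNeg : ∀ {p q} → 0ℚ ≤ p → 0ℚ ≤ q → 0ℚ ≤ p * q
*-nonNeg {p} {q} 0≤p 0≤q =
  ℚ.nonNegative⁻¹ (p * q) {{ℚ.nonNeg*nonNeg⇒nonNeg p {{ℚ.nonNegative 0≤p}} q {{ℚ.nonNegative 0≤q}}}}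

≤⇒≯ : ∀ {p q} → p ≤ q → ¬ q < p
≤⇒≯ p≤q q<p = ℚ.<-irrefl refl (ℚ.≤-<-trans p≤q q<p)

∑-last : ∀ n (f : ℕ → ℚ) → ∑[ j ≤ n ] f (toℕ j) ≡ ∑[ j < n ] f (toℕ j) + f n
∑-last n f = trans (sum-init-last {n} (f ∘ toℕ))
                   (cong₂ _+_ (sum-cong-≗ {n} (cong f ∘ toℕ-inject₁)) (cong f (toℕ-fromℕ n)))

∑-drop-last : ∀ n (f : ℕ → ℚ) → f n ≡ 0ℚ → ∑[ j ≤ n ] f (toℕ j) ≡ ∑[ j < n ] f (toℕ j)
∑-drop-last n f fn≡0 = begin
  ∑[ j ≤ n ] f (toℕ j)          ≡⟨ ∑-last n f ⟩
  ∑[ j < n ] f (toℕ j) + f n    ≡⟨ cong (∑[ j < n ] f (toℕ j) +_) fn≡0 ⟩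
  ∑[ j < n ] f (toℕ j) + 0ℚ     ≡⟨ ℚ.+-identityʳ (∑[ j < n ] f (toℕ j)) ⟩
  ∑[ j < n ] f (toℕ j)          ∎
  where open ≡-Reasoning

∑-zero : ∀ n (f : Fin n → ℚ) → (∀ j → f j ≡ 0ℚ) → ∑[ j < n ] f j ≡ 0ℚ
∑-zero n f f≗0 = trans (sum-cong-≗ {n} f≗0) (sum-replicate-zero n)

∑-nonNeg : ∀ n (f : Fin n → ℚ) → (∀ j → 0ℚ ≤ f j) → 0ℚ ≤ ∑[ j < n ] f j
∑-nonNeg zero    f 0≤f = ℚ.≤-refl
∑-nonNeg (suc n) f 0≤f = ℚ.+-mono-≤ (0≤f Fin.zero) (∑-nonNeg n (f ∘ Fin.suc) (0≤f ∘ Fin.suc))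

∑-term-≤ : ∀ n (f : Fin (suc n) → ℚ) → (∀ j → 0ℚ ≤ f j) → ∀ i → f i ≤ ∑[ j ≤ n ] f j
∑-term-≤ n f 0≤f i = begin
  f i                                   ≡⟨ ℚ.+-identityʳ (f i) ⟨
  f i + 0ℚ                              ≤⟨ ℚ.+-monoʳ-≤ (f i) (∑-nonNeg n (f ∘ punchIn i) (0≤f ∘ punchIn i)) ⟩
  f i + ∑[ j < n ] f (punchIn i j)  ≡⟨ sum-remove {n} {i} f ⟨
  ∑[ j ≤ n ] f j                        ∎
  where open ℚ.≤-Reasoning

-- Exponential power series

-- a : Series stands for Σ aₙ tⁿ/n!, so that ∂ is d/dt and ⊛, defined by the Leibniz rule, is the product.
Series : Set
Series = ℕ → ℚ

infixl 6 _⊕_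
infixl 7 _⊛_
infix  8 ⊝_

∂ : Series → Series
∂ a n = a (suc n)

_⊕_ : Series → Series → Series
(a ⊕ b) n = a n + b n

⊝_ : Series → Series
(⊝ a) n = - a n

0ₛ : Series
0ₛ _ = 0ℚ

constant : ℚ → Series
constant c zero    = c
constant c (suc _) = 0ℚ

1ₛ : Series
1ₛ = constant 1ℚ

_⊛_ : Series → Series → Series
(a ⊛ b) zero    = a 0 * b 0
(a ⊛ b) (suc n) = (∂ a ⊛ b) n + (a ⊛ ∂ b) n

⊛-cong : ∀ {a a′ b b′} → a ≗ a′ → b ≗ b′ → a ⊛ b ≗ a′ ⊛ b′
⊛-cong a≗a′ b≗b′ zero    = cong₂ _*_ (a≗a′ 0) (b≗b′ 0)
⊛-cong a≗a′ b≗b′ (suc n) =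
  cong₂ _+_ (⊛-cong (a≗a′ ∘ suc) b≗b′ n) (⊛-cong a≗a′ (b≗b′ ∘ suc) n)

⊛-comm : ∀ a b → a ⊛ b ≗ b ⊛ a
⊛-comm a b zero    = ℚ.*-comm (a 0) (b 0)
⊛-comm a b (suc n) = trans (cong₂ _+_ (⊛-comm (∂ a) b n) (⊛-comm a (∂ b) n))
                           (ℚ.+-comm ((b ⊛ ∂ a) n) ((∂ b ⊛ a) n))

⊛-distribʳ-⊕ : ∀ a b c → (a ⊕ b) ⊛ c ≗ a ⊛ c ⊕ b ⊛ c
⊛-distribʳ-⊕ a b c zero    = ℚ.*-distribʳ-+ (c 0) (a 0) (b 0)
⊛-distribʳ-⊕ a b c (suc n) = begin
  ((∂ a ⊕ ∂ b) ⊛ c) n + ((a ⊕ b) ⊛ ∂ c) n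
    ≡⟨ cong₂ _+_ (⊛-distribʳ-⊕ (∂ a) (∂ b) c n) (⊛-distribʳ-⊕ a b (∂ c) n) ⟩
  ((∂ a ⊛ c) n + (∂ b ⊛ c) n) + ((a ⊛ ∂ c) n + (b ⊛ ∂ c) n)
    ≡⟨ solve 4 (λ w x y z → (w :+ x) :+ (y :+ z) := (w :+ y) :+ (x :+ z)) refl
             ((∂ a ⊛ c) n) ((∂ b ⊛ c) n) ((a ⊛ ∂ c) n) ((b ⊛ ∂ c) n) ⟩
  ((∂ a ⊛ c) n + (a ⊛ ∂ c) n) + ((∂ b ⊛ c) n + (b ⊛ ∂ c) n)
    ∎
  where open ≡-Reasoning; open +-*-Solver

⊛-distribˡ-⊕ : ∀ a b c → a ⊛ (b ⊕ c) ≗ a ⊛ b ⊕ a ⊛ c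
⊛-distribˡ-⊕ a b c n = begin
  (a ⊛ (b ⊕ c)) n          ≡⟨ ⊛-comm a (b ⊕ c) n ⟩
  ((b ⊕ c) ⊛ a) n          ≡⟨ ⊛-distribʳ-⊕ b c a n ⟩
  (b ⊛ a) n + (c ⊛ a) n    ≡⟨ cong₂ _+_ (⊛-comm b a n) (⊛-comm c a n) ⟩
  (a ⊛ b) n + (a ⊛ c) n    ∎
  where open ≡-Reasoning

⊛-assoc : ∀ a b c → (a ⊛ b) ⊛ c ≗ a ⊛ (b ⊛ c)
⊛-assoc a b c zero    = ℚ.*-assoc (a 0) (b 0) (c 0)
⊛-assoc a b c (suc n) = begin
  ((∂ a ⊛ b ⊕ a ⊛ ∂ b) ⊛ c) n + ((a ⊛ b) ⊛ ∂ c) n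
    ≡⟨ cong (_+ ((a ⊛ b) ⊛ ∂ c) n) (⊛-distribʳ-⊕ (∂ a ⊛ b) (a ⊛ ∂ b) c n) ⟩
  ((∂ a ⊛ b) ⊛ c) n + ((a ⊛ ∂ b) ⊛ c) n + ((a ⊛ b) ⊛ ∂ c) n
    ≡⟨ cong₂ _+_ (cong₂ _+_ (⊛-assoc (∂ a) b c n) (⊛-assoc a (∂ b) c n)) (⊛-assoc a b (∂ c) n) ⟩
  (∂ a ⊛ (b ⊛ c)) n + (a ⊛ (∂ b ⊛ c)) n + (a ⊛ (b ⊛ ∂ c)) n
    ≡⟨ ℚ.+-assoc (((∂ a) ⊛ (b ⊛ c)) n) _ _ ⟩
  (∂ a ⊛ (b ⊛ c)) n + ((a ⊛ (∂ b ⊛ c)) n + (a ⊛ (b ⊛ ∂ c)) n)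
    ≡⟨ cong ((∂ a ⊛ (b ⊛ c)) n +_) (⊛-distribˡ-⊕ a (∂ b ⊛ c) (b ⊛ ∂ c) n) ⟨
  (∂ a ⊛ (b ⊛ c)) n + (a ⊛ (∂ b ⊛ c ⊕ b ⊛ ∂ c)) n
    ∎
  where open ≡-Reasoning

⊛-zeroˡ : ∀ a → 0ₛ ⊛ a ≗ 0ₛ
⊛-zeroˡ a zero    = ℚ.*-zeroˡ (a 0)
⊛-zeroˡ a (suc n) = cong₂ _+_ (⊛-zeroˡ a n) (⊛-zeroˡ (∂ a) n)

constant-⊛ : ∀ c a n → (constant c ⊛ a) n ≡ c * a n
constant-⊛ c a zero    = refl
constant-⊛ c a (suc n) = trans (cong (_+ (constant c ⊛ ∂ a) n) (⊛-zeroˡ a n))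
                               (trans (ℚ.+-identityˡ _) (constant-⊛ c (∂ a) n))

⊛-identityˡ : ∀ a → 1ₛ ⊛ a ≗ a
⊛-identityˡ a n = trans (constant-⊛ 1ℚ a n) (ℚ.*-identityˡ (a n))

⊛-commutativeRing : CommutativeRing 0ℓ 0ℓ
⊛-commutativeRing = record
  { Carrier = Series ; _≈_ = _≗_ ; _+_ = _⊕_ ; _*_ = _⊛_ ; -_ = ⊝_ ; 0# = 0ₛ ; 1# = 1ₛ
  ; isCommutativeRing = record
    { isRing = record
      { +-isAbelianGroup = Pointwise.isAbelianGroup ℕ ℚ.+-0-isAbelianGroup
      ; *-cong           = ⊛-cong
      ; *-assoc          = ⊛-assoc
      ; *-identity       = ⊛-identityˡ , λ a n → trans (⊛-comm a 1ₛ n) (⊛-identityˡ a n)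
      ; distrib          = ⊛-distribˡ-⊕ , λ c a b → ⊛-distribʳ-⊕ a b c
      }
    ; *-comm = ⊛-comm
    }
  }

constant-homomorphism : ℚ.+-*-rawRing -Raw-AlmostCommutative⟶ fromCommutativeRing ⊛-commutativeRing
constant-homomorphism = record
  { ⟦_⟧    = constant
  ; +-homo = λ { c d zero → refl ; c d (suc n) → sym (ℚ.+-identityˡ 0ℚ) }
  ; *-homo = λ c d n → sym (trans (constant-⊛ c (constant d) n) (scale c d n))
  ; -‿homo = λ { c zero → refl ; c (suc n) → refl }
  ; 0-homo = λ { zero → refl ; (suc n) → refl }
  ; 1-homo = λ _ → refl
  }
  where
  scale : ∀ c d n → c * constant d n ≡ constant (c * d) n
  scale c d zero    = refl
  scale c d (suc n) = ℚ.*-zeroʳ c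

constant-≟ : ∀ c d → Maybe (constant c ≗ constant d)
constant-≟ c d = Maybe.map (λ { refl _ → refl }) (dec⇒maybe (c ℚ.≟ d))

module ⊛-Solver = Algebra.Solver.Ring ℚ.+-*-rawRing (fromCommutativeRing ⊛-commutativeRing)
  constant-homomorphism constant-≟

private
  module ⊛ = CommutativeRing ⊛-commutativeRing
  module ⊛-Properties = RingProperties ⊛.ring

binomialTerm : Series → Series → ℕ → ℕ → ℚ
binomialTerm a b n j = ℕtoℚ (n C j) * (a j * b (n ∸ j))

⊛-binomial : ∀ a b n → (a ⊛ b) n ≡ ∑[ j ≤ n ] binomialTerm a b n (toℕ j)
⊛-binomial a b zero    = sym (trans (ℚ.+-identityʳ (1ℚ * (a 0 * b 0))) (ℚ.*-identityˡ (a 0 * b 0)))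
⊛-binomial a b (suc n) = begin
  (∂ a ⊛ b) n + (a ⊛ ∂ b) n
    ≡⟨ cong₂ _+_ (⊛-binomial (∂ a) b n) (⊛-binomial a (∂ b) n) ⟩
  ∑[ j ≤ n ] binomialTerm (∂ a) b n (toℕ j) + (first + ∑[ j < n ] shifted (toℕ j))
    ≡⟨ cong (λ s → ∑[ j ≤ n ] binomialTerm (∂ a) b n (toℕ j) + (first + s)) (sym shifted-sum) ⟩
  ∑[ j ≤ n ] binomialTerm (∂ a) b n (toℕ j) + (first + ∑[ j ≤ n ] upper (toℕ j))
    ≡⟨ solve 3 (λ x y z → x :+ (y :+ z) := y :+ (x :+ z)) refl
             (∑[ j ≤ n ] binomialTerm (∂ a) b n (toℕ j)) first (∑[ j ≤ n ] upper (toℕ j)) ⟩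
  first + (∑[ j ≤ n ] binomialTerm (∂ a) b n (toℕ j) + ∑[ j ≤ n ] upper (toℕ j))
    ≡⟨ cong (first +_) (sym (∑-distrib-+ {suc n} (binomialTerm (∂ a) b n ∘ toℕ) (upper ∘ toℕ))) ⟩
  first + ∑[ j ≤ n ] (binomialTerm (∂ a) b n (toℕ j) + upper (toℕ j))
    ≡⟨ cong (first +_) (sum-cong-≗ {suc n} (pascal ∘ toℕ)) ⟩
  first + ∑[ j ≤ n ] binomialTerm a b (suc n) (suc (toℕ j))
    ∎
  where
  open ≡-Reasoning
  open +-*-Solver
  first = binomialTerm a b (suc n) 0
  upper : ℕ → ℚ
  upper j = ℕtoℚ (n C suc j) * (a (suc j) * b (n ∸ j))
  shifted : ℕ → ℚ
  shifted j = binomialTerm a (∂ b) n (suc j)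
  shifted-sum : ∑[ j ≤ n ] upper (toℕ j) ≡ ∑[ j < n ] shifted (toℕ j)
  shifted-sum = trans (∑-drop-last n upper (trans (cong (λ c → ℕtoℚ c * (a (suc n) * b (n ∸ n)))
                                                        (k>n⇒nCk≡0 (ℕ.n<1+n n)))
                                                  (ℚ.*-zeroˡ (a (suc n) * b (n ∸ n)))))
                      (sum-cong-≗ {n} λ j → cong (λ m → ℕtoℚ (n C suc (toℕ j)) * (a (suc (toℕ j)) * b m))
                                             (ℕ.+-∸-assoc 1 (toℕ<n j)))
  pascal : ∀ j → binomialTerm (∂ a) b n j + upper j ≡ binomialTerm a b (suc n) (suc j)
  pascal j = begin
    ℕtoℚ (n C j) * x + ℕtoℚ (n C suc j) * x   ≡⟨ ℚ.*-distribʳ-+ x (ℕtoℚ (n C j)) (ℕtoℚ (n C suc j)) ⟨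
    (ℕtoℚ (n C j) + ℕtoℚ (n C suc j)) * x     ≡⟨ cong (_* x) (ℕtoℚ-homo-+ (n C j) (n C suc j)) ⟨
    ℕtoℚ (n C j ℕ.+ n C suc j) * x            ≡⟨ cong (λ c → ℕtoℚ c * x) (nCk+nC[k+1]≡[n+1]C[k+1] n j) ⟩
    ℕtoℚ (suc n C suc j) * x                  ∎
    where x = a (suc j) * b (n ∸ j)

binomialTerm-zeroˡ : ∀ a b n j → a j ≡ 0ℚ → binomialTerm a b n j ≡ 0ℚ
binomialTerm-zeroˡ a b n j aj≡0 = begin
  ℕtoℚ (n C j) * (a j * b (n ∸ j))  ≡⟨ cong (λ x → ℕtoℚ (n C j) * (x * b (n ∸ j))) aj≡0 ⟩
  ℕtoℚ (n C j) * (0ℚ * b (n ∸ j))   ≡⟨ cong (ℕtoℚ (n C j) *_) (ℚ.*-zeroˡ (b (n ∸ j))) ⟩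
  ℕtoℚ (n C j) * 0ℚ                 ≡⟨ ℚ.*-zeroʳ (ℕtoℚ (n C j)) ⟩
  0ℚ                                ∎
  where open ≡-Reasoning

binomialTerm-zeroʳ : ∀ a b n j → b (n ∸ j) ≡ 0ℚ → binomialTerm a b n j ≡ 0ℚ
binomialTerm-zeroʳ a b n j b≡0 = begin
  ℕtoℚ (n C j) * (a j * b (n ∸ j))  ≡⟨ cong (λ x → ℕtoℚ (n C j) * (a j * x)) b≡0 ⟩
  ℕtoℚ (n C j) * (a j * 0ℚ)         ≡⟨ cong (ℕtoℚ (n C j) *_) (ℚ.*-zeroʳ (a j)) ⟩
  ℕtoℚ (n C j) * 0ℚ                 ≡⟨ ℚ.*-zeroʳ (ℕtoℚ (n C j)) ⟩
  0ℚ                                ∎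
  where open ≡-Reasoning

binomialTerm-nonNeg : ∀ a b n j → 0ℚ ≤ a j → 0ℚ ≤ b (n ∸ j) → 0ℚ ≤ binomialTerm a b n j
binomialTerm-nonNeg a b n j 0≤a 0≤b =
  *-nonNeg (ℚ.nonNegative⁻¹ (ℕtoℚ (n C j)) {{ℕtoℚ-nonNeg (n C j)}}) (*-nonNeg 0≤a 0≤b)

⊛-interior : ∀ a b n → a 0 ≡ 0ℚ → b 0 ≡ 0ℚ →
             (a ⊛ b) (suc n) ≡ ∑[ j < n ] binomialTerm a b (suc n) (suc (toℕ j))
⊛-interior a b n a₀≡0 b₀≡0 = begin
  (a ⊛ b) (suc n)
    ≡⟨ ⊛-binomial a b (suc n) ⟩
  binomialTerm a b (suc n) 0 + ∑[ j ≤ n ] binomialTerm a b (suc n) (suc (toℕ j))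
    ≡⟨ cong₂ _+_ (binomialTerm-zeroˡ a b (suc n) 0 a₀≡0)
                 (∑-drop-last n (binomialTerm a b (suc n) ∘ suc)
                    (binomialTerm-zeroʳ a b (suc n) (suc n) (trans (cong b (ℕ.n∸n≡0 n)) b₀≡0))) ⟩
  0ℚ + ∑[ j < n ] binomialTerm a b (suc n) (suc (toℕ j))
    ≡⟨ ℚ.+-identityˡ (∑[ j < n ] binomialTerm a b (suc n) (suc (toℕ j))) ⟩
  ∑[ j < n ] binomialTerm a b (suc n) (suc (toℕ j))
    ∎
  where open ≡-Reasoning

⊛-leading : ∀ a b n → (∀ {j} → j ℕ.< n → a j ≡ 0ℚ) → (a ⊛ b) n ≡ a n * b 0
⊛-leading a b zero    a<n≡0 = refl
⊛-leading a b (suc n) a<n≡0 = begin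
  (∂ a ⊛ b) n + (a ⊛ ∂ b) n   ≡⟨ cong₂ _+_ (⊛-leading (∂ a) b n (a<n≡0 ∘ s≤s))
                                           (⊛-leading a (∂ b) n (a<n≡0 ∘ ℕ.m<n⇒m<1+n)) ⟩
  a (suc n) * b 0 + a n * b 1 ≡⟨ cong (λ x → a (suc n) * b 0 + x * b 1) (a<n≡0 (ℕ.n<1+n n)) ⟩
  a (suc n) * b 0 + 0ℚ * b 1  ≡⟨ cong (a (suc n) * b 0 +_) (ℚ.*-zeroˡ (b 1)) ⟩
  a (suc n) * b 0 + 0ℚ        ≡⟨ ℚ.+-identityʳ (a (suc n) * b 0) ⟩
  a (suc n) * b 0             ∎
  where open ≡-Reasoning

⊛-subleading : ∀ a b n → (∀ {j} → j ℕ.< n → a j ≡ 0ℚ) →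
               (a ⊛ b) (suc n) ≡ ℕtoℚ (suc n) * (a n * b 1) + a (suc n) * b 0
⊛-subleading a b zero    _     =
  solve 4 (λ a₀ a₁ b₀ b₁ → a₁ :* b₀ :+ a₀ :* b₁ := con 1ℚ :* (a₀ :* b₁) :+ a₁ :* b₀)
        refl (a 0) (a 1) (b 0) (b 1)
  where open +-*-Solver
⊛-subleading a b (suc n) a<n≡0 = begin
  (∂ a ⊛ b) (suc n) + (a ⊛ ∂ b) (suc n)
    ≡⟨ cong₂ _+_ (⊛-subleading (∂ a) b n (a<n≡0 ∘ s≤s)) (⊛-leading a (∂ b) (suc n) a<n≡0) ⟩
  ℕtoℚ (suc n) * x + y + x
    ≡⟨ solve 3 (λ k x y → k :* x :+ y :+ x := (con 1ℚ :+ k) :* x :+ y) refl (ℕtoℚ (suc n)) x y ⟩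
  (1ℚ + ℕtoℚ (suc n)) * x + y
    ≡⟨ cong (λ k → k * x + y) (ℕtoℚ-homo-+ 1 (suc n)) ⟨
  ℕtoℚ (suc (suc n)) * x + y
    ∎
  where
  open ≡-Reasoning
  open +-*-Solver
  x = a (suc n) * b 1
  y = a (suc (suc n)) * b 0

⊛-cancelʳ : ∀ a e → e 0 ≡ 0ℚ → e 1 ≡ 1ℚ → a ⊛ e ≗ 0ₛ → a ≗ 0ₛ
⊛-cancelʳ a e e₀≡0 e₁≡1 ae≗0 = <-rec (λ n → a n ≡ 0ℚ) step
  where
  step : ∀ n → (∀ {j} → j ℕ.< n → a j ≡ 0ℚ) → a n ≡ 0ℚ
  step n a<n≡0 = pos*p≡0⇒p≡0 (ℕtoℚ (suc n)) {{ℕtoℚ-pos n}} (begin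
    ℕtoℚ (suc n) * a n
      ≡⟨ solve 3 (λ k x y → k :* x := k :* (x :* con 1ℚ) :+ y :* con 0ℚ) refl (ℕtoℚ (suc n)) (a n) (a (suc n)) ⟩
    ℕtoℚ (suc n) * (a n * 1ℚ) + a (suc n) * 0ℚ
      ≡⟨ cong₂ (λ u v → ℕtoℚ (suc n) * (a n * u) + a (suc n) * v) e₁≡1 e₀≡0 ⟨
    ℕtoℚ (suc n) * (a n * e 1) + a (suc n) * e 0
      ≡⟨ ⊛-subleading a e n a<n≡0 ⟨
    (a ⊛ e) (suc n)
      ≡⟨ ae≗0 (suc n) ⟩
    0ℚ
      ∎)
    where open ≡-Reasoning; open +-*-Solver

X : Series
X 1 = 1ℚ
X _ = 0ℚ

∂X≗1ₛ : ∂ X ≗ 1ₛ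
∂X≗1ₛ zero    = refl
∂X≗1ₛ (suc n) = refl

X-⊛ : ∀ a n → (X ⊛ a) (suc n) ≡ ℕtoℚ (suc n) * a n
X-⊛ a zero    = solve 2 (λ a₀ a₁ → con 1ℚ :* a₀ :+ con 0ℚ :* a₁ := con 1ℚ :* a₀) refl (a 0) (a 1)
  where open +-*-Solver
X-⊛ a (suc n) = begin
  (∂ X ⊛ a) (suc n) + (X ⊛ ∂ a) (suc n)      ≡⟨ cong₂ _+_ (trans (⊛-cong ∂X≗1ₛ (λ _ → refl) (suc n))
                                                                  (⊛-identityˡ a (suc n)))
                                                           (X-⊛ (∂ a) n) ⟩
  a (suc n) + ℕtoℚ (suc n) * a (suc n)       ≡⟨ solve 2 (λ x k → x :+ k :* x := (con 1ℚ :+ k) :* x) refl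
                                                       (a (suc n)) (ℕtoℚ (suc n)) ⟩
  (1ℚ + ℕtoℚ (suc n)) * a (suc n)            ≡⟨ cong (_* a (suc n)) (ℕtoℚ-homo-+ 1 (suc n)) ⟨
  ℕtoℚ (suc (suc n)) * a (suc n)             ∎
  where open ≡-Reasoning; open +-*-Solver

X-⊛-∂ : ∀ a n → (X ⊛ ∂ a) n ≡ ℕtoℚ n * a n
X-⊛-∂ a zero    = trans (ℚ.*-zeroˡ (a 1)) (sym (ℚ.*-zeroˡ (a 0)))
X-⊛-∂ a (suc n) = X-⊛ (∂ a) n

-- Bernoulli numbers

-- In Defs the where-bound v = bernoulliVec n is re-expanded at each of its uses, so evaluating
-- bernoulli on a numeral takes time exponential in it; passing the vector as an argument shares it.
bernoulliStep : (n : ℕ) → Vec ℚ (suc n) → Vec ℚ (suc (suc n))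
bernoulliStep n v = v ∷ʳ (ℤ.+ 1 / suc (suc n)) * (ℕtoℚ (suc (suc n)) - s)
  where s = sumℚ (tabulate (λ (j : Fin (suc n)) → ℕtoℚ (suc (suc n) C toℕ j) * lookup v j))

bernoulliVec′ : (n : ℕ) → Vec ℚ (suc n)
bernoulliVec′ zero    = 1ℚ ∷ []
bernoulliVec′ (suc n) = bernoulliStep n (bernoulliVec′ n)

bernoulliVec≡bernoulliVec′ : ∀ n → bernoulliVec n ≡ bernoulliVec′ n
bernoulliVec≡bernoulliVec′ zero    = refl
bernoulliVec≡bernoulliVec′ (suc n) = cong (bernoulliStep n) (bernoulliVec≡bernoulliVec′ n)

bernoulli-via-bernoulliVec′ : ∀ n → bernoulli n ≡ lookup (bernoulliVec′ n) (fromℕ n)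
bernoulli-via-bernoulliVec′ n = cong (λ v → lookup v (fromℕ n)) (bernoulliVec≡bernoulliVec′ n)

lookup-∷ʳ-fromℕ : ∀ {n} (v : Vec ℚ n) x → lookup (v ∷ʳ x) (fromℕ n) ≡ x
lookup-∷ʳ-fromℕ []      x = refl
lookup-∷ʳ-fromℕ (y ∷ v) x = lookup-∷ʳ-fromℕ v x

lookup-∷ʳ-inject₁ : ∀ {n} (v : Vec ℚ n) x i → lookup (v ∷ʳ x) (inject₁ i) ≡ lookup v i
lookup-∷ʳ-inject₁ (y ∷ v) x Fin.zero    = refl
lookup-∷ʳ-inject₁ (y ∷ v) x (Fin.suc i) = lookup-∷ʳ-inject₁ v x i

lookup-bernoulliVec : ∀ n (j : Fin (suc n)) → lookup (bernoulliVec n) j ≡ bernoulli (toℕ j)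
lookup-bernoulliVec zero    Fin.zero = refl
lookup-bernoulliVec (suc n) j with view j
... | ‵fromℕ     = cong bernoulli (sym (toℕ-fromℕ (suc n)))
... | ‵inject₁ i = begin
  lookup (bernoulliVec n ∷ʳ _) (inject₁ i)  ≡⟨ lookup-∷ʳ-inject₁ (bernoulliVec n) _ i ⟩
  lookup (bernoulliVec n) i                 ≡⟨ lookup-bernoulliVec n i ⟩
  bernoulli (toℕ i)                         ≡⟨ cong bernoulli (toℕ-inject₁ i) ⟨
  bernoulli (toℕ (inject₁ i))               ∎
  where open ≡-Reasoning

sumℚ-tabulate : ∀ n (f : Fin n → ℚ) → sumℚ (tabulate f) ≡ ∑[ j < n ] f j
sumℚ-tabulate zero    f = refl
sumℚ-tabulate (suc n) f = cong (f Fin.zero +_) (sumℚ-tabulate n (f ∘ Fin.suc))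

bernoulli-recurrence : ∀ n → ∑[ j ≤ n ] (ℕtoℚ (suc n C toℕ j) * bernoulli (toℕ j)) ≡ ℕtoℚ (suc n)
bernoulli-recurrence zero    = refl
bernoulli-recurrence (suc n) = begin
  ∑[ j ≤ suc n ] (ℕtoℚ (N C toℕ j) * bernoulli (toℕ j))
    ≡⟨ ∑-last (suc n) (λ j → ℕtoℚ (N C j) * bernoulli j) ⟩
  s + ℕtoℚ (N C suc n) * bernoulli (suc n)
    ≡⟨ cong₂ (λ c b → s + ℕtoℚ c * b) N-choose-N∸1 (lookup-∷ʳ-fromℕ (bernoulliVec n) _) ⟩
  s + ℕtoℚ N * ((ℤ.+ 1 / N) * (ℕtoℚ N - s′))
    ≡⟨ cong (λ t → s + ℕtoℚ N * ((ℤ.+ 1 / N) * (ℕtoℚ N - t))) s′≡s ⟩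
  s + ℕtoℚ N * ((ℤ.+ 1 / N) * (ℕtoℚ N - s))
    ≡⟨ solve 3 (λ s k i → s :+ k :* (i :* (k :- s)) := s :+ (k :* i) :* (k :- s)) refl s (ℕtoℚ N) (ℤ.+ 1 / N) ⟩
  s + (ℕtoℚ N * (ℤ.+ 1 / N)) * (ℕtoℚ N - s)
    ≡⟨ cong (λ u → s + u * (ℕtoℚ N - s)) (ℕtoℚ-inverseʳ (suc n)) ⟩
  s + 1ℚ * (ℕtoℚ N - s)
    ≡⟨ solve 2 (λ s k → s :+ con 1ℚ :* (k :- s) := k) refl s (ℕtoℚ N) ⟩
  ℕtoℚ N
    ∎
  where
  open ≡-Reasoning
  open +-*-Solver
  N = suc (suc n)
  s = ∑[ j ≤ n ] (ℕtoℚ (N C toℕ j) * bernoulli (toℕ j))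
  s′ = sumℚ (tabulate (λ (j : Fin (suc n)) → ℕtoℚ (N C toℕ j) * lookup (bernoulliVec n) j))
  s′≡s : s′ ≡ s
  s′≡s = trans (sumℚ-tabulate (suc n) (λ j → ℕtoℚ (N C toℕ j) * lookup (bernoulliVec n) j))
               (sum-cong-≗ {suc n} λ j → cong (ℕtoℚ (N C toℕ j) *_) (lookup-bernoulliVec n j))
  N-choose-N∸1 : N C suc n ≡ N
  N-choose-N∸1 = trans (nCk≡nC[n∸k] (ℕ.n≤1+n (suc n))) (trans (cong (N C_) (ℕ.m+n∸n≡m 1 n)) (nC1≡n N))

expₛ : Series
expₛ _ = 1ℚ

bernoulli-⊛-exp : bernoulli ⊛ expₛ ≗ bernoulli ⊕ X ⊛ expₛ
bernoulli-⊛-exp zero    = refl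
bernoulli-⊛-exp (suc n) = begin
  (bernoulli ⊛ expₛ) (suc n)
    ≡⟨ ⊛-binomial bernoulli expₛ (suc n) ⟩
  ∑[ j ≤ suc n ] binomialTerm bernoulli expₛ (suc n) (toℕ j)
    ≡⟨ ∑-last (suc n) (binomialTerm bernoulli expₛ (suc n)) ⟩
  ∑[ j ≤ n ] binomialTerm bernoulli expₛ (suc n) (toℕ j) + binomialTerm bernoulli expₛ (suc n) (suc n)
    ≡⟨ cong₂ _+_ (trans (sum-cong-≗ {suc n} λ j → cong (ℕtoℚ (suc n C toℕ j) *_)
                                                            (ℚ.*-identityʳ (bernoulli (toℕ j))))
                        (bernoulli-recurrence n))
                 (cong (λ c → ℕtoℚ c * (bernoulli (suc n) * 1ℚ)) (nCn≡1 (suc n))) ⟩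
  ℕtoℚ (suc n) + 1ℚ * (bernoulli (suc n) * 1ℚ)
    ≡⟨ solve 2 (λ k b → k :+ con 1ℚ :* (b :* con 1ℚ) := b :+ k :* con 1ℚ) refl
             (ℕtoℚ (suc n)) (bernoulli (suc n)) ⟩
  bernoulli (suc n) + ℕtoℚ (suc n) * 1ℚ
    ≡⟨ cong (bernoulli (suc n) +_) (X-⊛ expₛ n) ⟨
  bernoulli (suc n) + (X ⊛ expₛ) (suc n)
    ∎
  where open ≡-Reasoning; open +-*-Solver

∂-bernoulli-⊛-exp : ∂ bernoulli ⊛ expₛ ⊕ bernoulli ⊛ expₛ ≗ ∂ bernoulli ⊕ expₛ ⊕ X ⊛ expₛ
∂-bernoulli-⊛-exp n = begin
  (∂ bernoulli ⊛ expₛ) n + (bernoulli ⊛ expₛ) n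
    ≡⟨ bernoulli-⊛-exp (suc n) ⟩
  bernoulli (suc n) + ((∂ X ⊛ expₛ) n + (X ⊛ expₛ) n)
    ≡⟨ cong (λ x → bernoulli (suc n) + (x + (X ⊛ expₛ) n))
            (trans (⊛-cong ∂X≗1ₛ (λ _ → refl) n) (⊛-identityˡ expₛ n)) ⟩
  bernoulli (suc n) + (1ℚ + (X ⊛ expₛ) n)
    ≡⟨ ℚ.+-assoc (bernoulli (suc n)) 1ℚ ((X ⊛ expₛ) n) ⟨
  bernoulli (suc n) + 1ℚ + (X ⊛ expₛ) n
    ∎
  where open ≡-Reasoning

-- With D = B (eᵗ − 1) − t eᵗ = 0: (t B′ + B² − B − t B)(eᵗ − 1) = t D′ + (B − t − 1) D.
bernoulli-riccati : X ⊛ ∂ bernoulli ⊕ bernoulli ⊛ bernoulli ≗ bernoulli ⊕ X ⊛ bernoulli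
bernoulli-riccati = ⊛-Properties.x∙y⁻¹≈ε⇒x≈y _ _ (⊛-cancelʳ _ (expₛ ⊕ ⊝ 1ₛ) refl refl product≗0)
  where
  open ⊛-Solver
  open import Relation.Binary.Reasoning.Setoid ⊛.setoid renaming (begin_ to beginₛ_; _∎ to _∎ₛ)
  B = bernoulli
  product≗0 : (X ⊛ ∂ B ⊕ B ⊛ B ⊕ ⊝ (B ⊕ X ⊛ B)) ⊛ (expₛ ⊕ ⊝ 1ₛ) ≗ 0ₛ
  product≗0 = beginₛ
    (X ⊛ ∂ B ⊕ B ⊛ B ⊕ ⊝ (B ⊕ X ⊛ B)) ⊛ (expₛ ⊕ ⊝ 1ₛ)
      ≈⟨ solve 4 (λ b′ b e x →
           (x :* b′ :+ b :* b :+ :- (b :+ x :* b)) :* (e :+ :- con 1ℚ)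
             := x :* (b′ :* e :+ b :* e :+ :- (b′ :+ e :+ x :* e))
                :+ (b :+ :- x :+ :- con 1ℚ) :* (b :* e :+ :- (b :+ x :* e)))
           (λ _ → refl) (∂ B) B expₛ X ⟩
    X ⊛ (∂ B ⊛ expₛ ⊕ B ⊛ expₛ ⊕ ⊝ (∂ B ⊕ expₛ ⊕ X ⊛ expₛ))
      ⊕ (B ⊕ ⊝ X ⊕ ⊝ 1ₛ) ⊛ (B ⊛ expₛ ⊕ ⊝ (B ⊕ X ⊛ expₛ))
      ≈⟨ ⊛.+-cong (⊛.*-congˡ (⊛-Properties.x≈y⇒x∙y⁻¹≈ε ∂-bernoulli-⊛-exp))
                  (⊛.*-congˡ (⊛-Properties.x≈y⇒x∙y⁻¹≈ε bernoulli-⊛-exp)) ⟩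
    X ⊛ 0ₛ ⊕ (B ⊕ ⊝ X ⊕ ⊝ 1ₛ) ⊛ 0ₛ
      ≈⟨ ⊛.+-cong (⊛.zeroʳ X) (⊛.zeroʳ (B ⊕ ⊝ X ⊕ ⊝ 1ₛ)) ⟩
    0ₛ ⊕ 0ₛ
      ≈⟨ ⊛.+-identityʳ 0ₛ ⟩
    0ₛ
      ∎ₛ

bernoulli≥2 : Series
bernoulli≥2 0             = 0ℚ
bernoulli≥2 1             = 0ℚ
bernoulli≥2 (suc (suc n)) = bernoulli (suc (suc n))

quarterX² : Series
quarterX² 2 = ½
quarterX² _ = 0ℚ

bernoulli≥2-as-series : bernoulli≥2 ≗ bernoulli ⊕ ⊝ 1ₛ ⊕ ⊝ (constant ½ ⊛ X)
bernoulli≥2-as-series 0             = refl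
bernoulli≥2-as-series 1             = refl
bernoulli≥2-as-series (suc (suc n)) = sym (begin
  bernoulli (suc (suc n)) + - 0ℚ + - (constant ½ ⊛ X) (suc (suc n))
    ≡⟨ cong (λ x → bernoulli (suc (suc n)) + - 0ℚ + - x) (constant-⊛ ½ X (suc (suc n))) ⟩
  bernoulli (suc (suc n)) + 0ℚ + 0ℚ
    ≡⟨ trans (ℚ.+-identityʳ _) (ℚ.+-identityʳ (bernoulli (suc (suc n)))) ⟩
  bernoulli (suc (suc n))
    ∎)
  where open ≡-Reasoning

∂-bernoulli≥2 : ∂ bernoulli≥2 ≗ ∂ bernoulli ⊕ ⊝ constant ½
∂-bernoulli≥2 zero    = refl
∂-bernoulli≥2 (suc n) = sym (ℚ.+-identityʳ (bernoulli (suc (suc n))))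

quarterX²-as-series : constant (½ * ½) ⊛ (X ⊛ X) ≗ quarterX²
quarterX²-as-series 0                   = refl
quarterX²-as-series 1                   = refl
quarterX²-as-series 2                   = refl
quarterX²-as-series (suc (suc (suc n))) = begin
  (constant (½ * ½) ⊛ (X ⊛ X)) (3 ℕ.+ n)   ≡⟨ constant-⊛ (½ * ½) (X ⊛ X) (3 ℕ.+ n) ⟩
  (½ * ½) * (X ⊛ X) (3 ℕ.+ n)               ≡⟨ cong ((½ * ½) *_) (X-⊛ X (2 ℕ.+ n)) ⟩
  (½ * ½) * (ℕtoℚ (3 ℕ.+ n) * 0ℚ)           ≡⟨ cong ((½ * ½) *_) (ℚ.*-zeroʳ (ℕtoℚ (3 ℕ.+ n))) ⟩
  0ℚ                                        ∎
  where open ≡-Reasoning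

bernoulli≥2-riccati : X ⊛ ∂ bernoulli≥2 ⊕ bernoulli≥2 ⊕ bernoulli≥2 ⊛ bernoulli≥2 ≗ quarterX²
bernoulli≥2-riccati = beginₛ
  X ⊛ ∂ F ⊕ F ⊕ F ⊛ F
    ≈⟨ ⊛.+-cong (⊛.+-cong (⊛.*-congˡ ∂-bernoulli≥2) bernoulli≥2-as-series)
                (⊛.*-cong bernoulli≥2-as-series bernoulli≥2-as-series) ⟩
  X ⊛ (∂ B ⊕ ⊝ constant ½) ⊕ (B ⊕ ⊝ 1ₛ ⊕ ⊝ (constant ½ ⊛ X))
    ⊕ (B ⊕ ⊝ 1ₛ ⊕ ⊝ (constant ½ ⊛ X)) ⊛ (B ⊕ ⊝ 1ₛ ⊕ ⊝ (constant ½ ⊛ X))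
    ≈⟨ solve 3 (λ b′ b x →
         x :* (b′ :+ :- con ½) :+ (b :+ :- con 1ℚ :+ :- (con ½ :* x))
           :+ (b :+ :- con 1ℚ :+ :- (con ½ :* x)) :* (b :+ :- con 1ℚ :+ :- (con ½ :* x))
         := con (½ * ½) :* (x :* x) :+ ((x :* b′ :+ b :* b) :+ :- (b :+ x :* b)))
         (λ _ → refl) (∂ B) B X ⟩
  constant (½ * ½) ⊛ (X ⊛ X) ⊕ ((X ⊛ ∂ B ⊕ B ⊛ B) ⊕ ⊝ (B ⊕ X ⊛ B))
    ≈⟨ ⊛.+-cong quarterX²-as-series (⊛-Properties.x≈y⇒x∙y⁻¹≈ε bernoulli-riccati) ⟩
  quarterX² ⊕ 0ₛ
    ≈⟨ ⊛.+-identityʳ quarterX² ⟩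
  quarterX²
    ∎ₛ
  where
  open ⊛-Solver
  open import Relation.Binary.Reasoning.Setoid ⊛.setoid renaming (begin_ to beginₛ_; _∎ to _∎ₛ)
  B = bernoulli
  F = bernoulli≥2

bernoulli≥2-recurrence : ∀ n →
  ℕtoℚ (suc n) * bernoulli≥2 n + (bernoulli≥2 ⊛ bernoulli≥2) n ≡ quarterX² n
bernoulli≥2-recurrence n = begin
  ℕtoℚ (suc n) * F n + (F ⊛ F) n          ≡⟨ cong (λ k → k * F n + (F ⊛ F) n) (ℕtoℚ-homo-+ 1 n) ⟩
  (1ℚ + ℕtoℚ n) * F n + (F ⊛ F) n         ≡⟨ solve 3 (λ k f p → (con 1ℚ :+ k) :* f :+ p := k :* f :+ f :+ p)
                                                   refl (ℕtoℚ n) (F n) ((F ⊛ F) n) ⟩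
  ℕtoℚ n * F n + F n + (F ⊛ F) n          ≡⟨ cong (λ x → x + F n + (F ⊛ F) n) (X-⊛-∂ F n) ⟨
  (X ⊛ ∂ F) n + F n + (F ⊛ F) n           ≡⟨ bernoulli≥2-riccati n ⟩
  quarterX² n                             ∎
  where
  open ≡-Reasoning
  open +-*-Solver
  F = bernoulli≥2

odd-summand : ∀ p q → p ℙ.+ q ≡ 1ℙ → p ≡ 1ℙ ⊎ q ≡ 1ℙ
odd-summand 0ℙ 1ℙ _ = inj₂ refl
odd-summand 1ℙ _  _ = inj₁ refl

-- For odd n, every interior term of (F ⊛ F) n has a factor Fⱼ with j < n odd.
bernoulli≥2-odd : ∀ n → parity n ≡ 1ℙ → bernoulli≥2 n ≡ 0ℚ
bernoulli≥2-odd = <-rec (λ n → parity n ≡ 1ℙ → bernoulli≥2 n ≡ 0ℚ) step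
  where
  step : ∀ n → (∀ {m} → m ℕ.< n → parity m ≡ 1ℙ → bernoulli≥2 m ≡ 0ℚ) →
         parity n ≡ 1ℙ → bernoulli≥2 n ≡ 0ℚ
  step 0                   _  ()
  step 1                   _  _ = refl
  step 2                   _  ()
  step n@(suc (suc (suc m))) ih odd = pos*p≡0⇒p≡0 (ℕtoℚ (suc n)) {{ℕtoℚ-pos n}} (begin
    ℕtoℚ (suc n) * F n                    ≡⟨ ℚ.+-identityʳ (ℕtoℚ (suc n) * F n) ⟨
    ℕtoℚ (suc n) * F n + 0ℚ               ≡⟨ cong (ℕtoℚ (suc n) * F n +_) square≡0 ⟨
    ℕtoℚ (suc n) * F n + (F ⊛ F) n        ≡⟨ bernoulli≥2-recurrence n ⟩
    0ℚ                                    ∎)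
    where
    open ≡-Reasoning
    F = bernoulli≥2
    term≡0 : ∀ (j : Fin (suc (suc m))) → binomialTerm F F n (suc (toℕ j)) ≡ 0ℚ
    term≡0 j with odd-summand (parity (suc (toℕ j))) (parity (suc (suc m) ∸ toℕ j))
                   (trans (sym (ℙ.+-homo-+ (suc (toℕ j)) (suc (suc m) ∸ toℕ j)))
                          (trans (cong (parity ∘ suc) (ℕ.m+[n∸m]≡n (ℕ.<⇒≤ (toℕ<n j)))) odd))
    ... | inj₁ odd-j   = binomialTerm-zeroˡ F F n (suc (toℕ j)) (ih (s≤s (toℕ<n j)) odd-j)
    ... | inj₂ odd-n∸j = binomialTerm-zeroʳ F F n (suc (toℕ j))
                             (ih (s≤s (ℕ.m∸n≤m (suc (suc m)) (toℕ j))) odd-n∸j)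
    square≡0 : (F ⊛ F) n ≡ 0ℚ
    square≡0 = trans (⊛-interior F F (suc (suc m)) refl refl) (∑-zero (suc (suc m)) _ term≡0)

-- Signs and growth

-- H(t) = −F(it) in coefficients: quarterSign n = −(−1)^⌊n/2⌋, and F vanishes at odd n.
quarterSign : ℕ → ℚ
quarterSign 0             = - 1ℚ
quarterSign 1             = - 1ℚ
quarterSign (suc (suc n)) = - quarterSign n

twistedBernoulli : Series
twistedBernoulli n = quarterSign n * bernoulli≥2 n

quarterSign-even-* : ∀ j k → parity j ≡ 0ℙ → quarterSign j * quarterSign k ≡ - quarterSign (j ℕ.+ k)
quarterSign-even-* 0             k _    = trans (sym (ℚ.neg-distribˡ-* 1ℚ (quarterSign k)))
                                                (cong -_ (ℚ.*-identityˡ (quarterSign k)))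
quarterSign-even-* (suc (suc j)) k even = trans (sym (ℚ.neg-distribˡ-* (quarterSign j) (quarterSign k)))
                                                (cong -_ (quarterSign-even-* j k even))

quarterSign-*-quarterX² : ∀ n → quarterSign n * quarterX² n ≡ quarterX² n
quarterSign-*-quarterX² 0                   = refl
quarterSign-*-quarterX² 1                   = refl
quarterSign-*-quarterX² 2                   = refl
quarterSign-*-quarterX² (suc (suc (suc n))) = ℚ.*-zeroʳ (quarterSign (3 ℕ.+ n))

twistedBernoulli-square : ∀ n →
  (twistedBernoulli ⊛ twistedBernoulli) n ≡ - (quarterSign n * (bernoulli≥2 ⊛ bernoulli≥2) n)
twistedBernoulli-square n = begin
  (H ⊛ H) n
    ≡⟨ ⊛-binomial H H n ⟩
  ∑[ j ≤ n ] binomialTerm H H n (toℕ j)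
    ≡⟨ sum-cong-≗ {suc n} (λ j → term (toℕ j) (ℕ.≤-pred (toℕ<n j))) ⟩
  ∑[ j ≤ n ] (- ρ n * binomialTerm F F n (toℕ j))
    ≡⟨ *-distribˡ-sum {suc n} (- ρ n) (binomialTerm F F n ∘ toℕ) ⟨
  - ρ n * ∑[ j ≤ n ] binomialTerm F F n (toℕ j)
    ≡⟨ cong (- ρ n *_) (⊛-binomial F F n) ⟨
  - ρ n * (F ⊛ F) n
    ≡⟨ ℚ.neg-distribˡ-* (ρ n) ((F ⊛ F) n) ⟨
  - (ρ n * (F ⊛ F) n)
    ∎
  where
  open ≡-Reasoning
  open +-*-Solver
  ρ = quarterSign
  F = bernoulli≥2
  H = twistedBernoulli
  term : ∀ j → j ℕ.≤ n → binomialTerm H H n j ≡ - ρ n * binomialTerm F F n j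
  term j j≤n with parity j in parity-j
  ... | 0ℙ = begin
    ℕtoℚ (n C j) * ((ρ j * F j) * (ρ (n ∸ j) * F (n ∸ j)))
      ≡⟨ solve 5 (λ c r s f g → c :* ((r :* f) :* (s :* g)) := (r :* s) :* (c :* (f :* g))) refl
               (ℕtoℚ (n C j)) (ρ j) (ρ (n ∸ j)) (F j) (F (n ∸ j)) ⟩
    (ρ j * ρ (n ∸ j)) * binomialTerm F F n j
      ≡⟨ cong (_* binomialTerm F F n j) (trans (quarterSign-even-* j (n ∸ j) parity-j)
                                               (cong (-_ ∘ ρ) (ℕ.m+[n∸m]≡n j≤n))) ⟩
    - ρ n * binomialTerm F F n j
      ∎
  ... | 1ℙ = trans (binomialTerm-zeroˡ H H n j (trans (cong (ρ j *_) Fj≡0) (ℚ.*-zeroʳ (ρ j))))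
                   (sym (trans (cong (- ρ n *_) (binomialTerm-zeroˡ F F n j Fj≡0)) (ℚ.*-zeroʳ (- ρ n))))
    where Fj≡0 = bernoulli≥2-odd j parity-j

twistedBernoulli-recurrence : ∀ n →
  ℕtoℚ (suc n) * twistedBernoulli n ≡ quarterX² n + (twistedBernoulli ⊛ twistedBernoulli) n
twistedBernoulli-recurrence n = begin
  ℕtoℚ (suc n) * (ρ n * F n)
    ≡⟨ solve 4 (λ k r f p → k :* (r :* f) := r :* (k :* f :+ p) :+ :- (r :* p)) refl
             (ℕtoℚ (suc n)) (ρ n) (F n) ((F ⊛ F) n) ⟩
  ρ n * (ℕtoℚ (suc n) * F n + (F ⊛ F) n) + - (ρ n * (F ⊛ F) n)
    ≡⟨ cong₂ _+_ (trans (cong (ρ n *_) (bernoulli≥2-recurrence n)) (quarterSign-*-quarterX² n))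
                 (sym (twistedBernoulli-square n)) ⟩
  quarterX² n + (twistedBernoulli ⊛ twistedBernoulli) n
    ∎
  where
  open ≡-Reasoning
  open +-*-Solver
  ρ = quarterSign
  F = bernoulli≥2

quarterX²-nonNeg : ∀ n → 0ℚ ≤ quarterX² n
quarterX²-nonNeg 0                   = ℚ.≤-refl
quarterX²-nonNeg 1                   = ℚ.≤-refl
quarterX²-nonNeg 2                   = ℚ.nonNegative⁻¹ ½
quarterX²-nonNeg (suc (suc (suc n))) = ℚ.≤-refl

twistedBernoulli-nonNeg : ∀ n → 0ℚ ≤ twistedBernoulli n
twistedBernoulli-nonNeg = <-rec (λ n → 0ℚ ≤ twistedBernoulli n) step
  where
  H = twistedBernoulli
  step : ∀ n → (∀ {m} → m ℕ.< n → 0ℚ ≤ H m) → 0ℚ ≤ H n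
  step zero    _  = ℚ.≤-refl
  step (suc n) ih = ℚ.*-cancelˡ-≤-pos (ℕtoℚ (2 ℕ.+ n)) {{ℕtoℚ-pos (suc n)}} (begin
    ℕtoℚ (2 ℕ.+ n) * 0ℚ                                    ≡⟨ ℚ.*-zeroʳ (ℕtoℚ (2 ℕ.+ n)) ⟩
    0ℚ                                                    ≤⟨ ℚ.+-mono-≤ (quarterX²-nonNeg (suc n)) interior-nonNeg ⟩
    quarterX² (suc n) + ∑[ j < n ] binomialTerm H H (suc n) (suc (toℕ j))
                                                          ≡⟨ cong (quarterX² (suc n) +_) (⊛-interior H H n refl refl) ⟨
    quarterX² (suc n) + (H ⊛ H) (suc n)                   ≡⟨ twistedBernoulli-recurrence (suc n) ⟨
    ℕtoℚ (2 ℕ.+ n) * H (suc n)                             ∎)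
    where
    open ℚ.≤-Reasoning
    interior-nonNeg : 0ℚ ≤ ∑[ j < n ] binomialTerm H H (suc n) (suc (toℕ j))
    interior-nonNeg = ∑-nonNeg n _ λ j →
      binomialTerm-nonNeg H H (suc n) (suc (toℕ j)) (ih (s≤s (toℕ<n j))) (ih (s≤s (ℕ.m∸n≤m n (toℕ j))))

twistedBernoulli-lower-bound : ∀ n →
  ℕtoℚ ((2 ℕ.+ n) C 2) * (twistedBernoulli 2 * twistedBernoulli n)
    ≤ ℕtoℚ (3 ℕ.+ n) * twistedBernoulli (2 ℕ.+ n)
twistedBernoulli-lower-bound n = begin
  binomialTerm H H (2 ℕ.+ n) 2
    ≤⟨ ∑-term-≤ (2 ℕ.+ n) (binomialTerm H H (2 ℕ.+ n) ∘ toℕ) nonNeg (Fin.suc (Fin.suc Fin.zero)) ⟩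
  ∑[ j ≤ 2 ℕ.+ n ] binomialTerm H H (2 ℕ.+ n) (toℕ j)
    ≡⟨ ⊛-binomial H H (2 ℕ.+ n) ⟨
  (H ⊛ H) (2 ℕ.+ n)
    ≡⟨ ℚ.+-identityˡ ((H ⊛ H) (2 ℕ.+ n)) ⟨
  0ℚ + (H ⊛ H) (2 ℕ.+ n)
    ≤⟨ ℚ.+-monoˡ-≤ ((H ⊛ H) (2 ℕ.+ n)) (quarterX²-nonNeg (2 ℕ.+ n)) ⟩
  quarterX² (2 ℕ.+ n) + (H ⊛ H) (2 ℕ.+ n)
    ≡⟨ twistedBernoulli-recurrence (2 ℕ.+ n) ⟨
  ℕtoℚ (3 ℕ.+ n) * H (2 ℕ.+ n)
    ∎
  where
  open ℚ.≤-Reasoning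
  H = twistedBernoulli
  nonNeg : ∀ j → 0ℚ ≤ binomialTerm H H (2 ℕ.+ n) (toℕ j)
  nonNeg j = binomialTerm-nonNeg H H (2 ℕ.+ n) (toℕ j) (twistedBernoulli-nonNeg (toℕ j))
                                                      (twistedBernoulli-nonNeg (2 ℕ.+ n ∸ toℕ j))

C[n,2]-double : ∀ n → 2 ℕ.* (suc n C 2) ≡ suc n ℕ.* n
C[n,2]-double zero    = refl
C[n,2]-double (suc n) = begin
  2 ℕ.* ((2 ℕ.+ n) C 2)                    ≡⟨ cong (2 ℕ.*_) (nCk+nC[k+1]≡[n+1]C[k+1] (suc n) 1) ⟨
  2 ℕ.* ((1 ℕ.+ n) C 1 ℕ.+ (1 ℕ.+ n) C 2)  ≡⟨ cong (λ c → 2 ℕ.* (c ℕ.+ (1 ℕ.+ n) C 2)) (nC1≡n (suc n)) ⟩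
  2 ℕ.* ((1 ℕ.+ n) ℕ.+ (1 ℕ.+ n) C 2)      ≡⟨ ℕ.*-distribˡ-+ 2 (suc n) (suc n C 2) ⟩
  2 ℕ.* (1 ℕ.+ n) ℕ.+ 2 ℕ.* ((1 ℕ.+ n) C 2) ≡⟨ cong (2 ℕ.* suc n ℕ.+_) (C[n,2]-double n) ⟩
  2 ℕ.* (1 ℕ.+ n) ℕ.+ (1 ℕ.+ n) ℕ.* n      ≡⟨ solve 1 (λ n → con 2 :* (con 1 :+ n) :+ (con 1 :+ n) :* n
                                                          := (con 2 :+ n) :* (con 1 :+ n)) refl n ⟩
  (2 ℕ.+ n) ℕ.* (1 ℕ.+ n)                  ∎
  where open ≡-Reasoning; open ℕ-Solver

-- For n = 14 + d: (n + 2)(n + 1) n − 12 (n + 3)(n + 2) = (n + 2)(d² + 17d + 6).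
cubic-bound : ∀ n → 14 ℕ.≤ n → 6 ℕ.* ((3 ℕ.+ n) ℕ.* (2 ℕ.+ n)) ℕ.< ((2 ℕ.+ n) C 2) ℕ.* n
cubic-bound n 14≤n = subst P (ℕ.m+[n∸m]≡n 14≤n) (bound (n ∸ 14))
  where
  P : ℕ → Set
  P n = 6 ℕ.* ((3 ℕ.+ n) ℕ.* (2 ℕ.+ n)) ℕ.< ((2 ℕ.+ n) C 2) ℕ.* n
  bound : ∀ d → P (14 ℕ.+ d)
  bound d = ℕ.*-cancelˡ-< 2 _ _ (subst (2 ℕ.* L ℕ.<_) expansion (ℕ.m<m+n (2 ℕ.* L) (s≤s z≤n)))
    where
    open ℕ-Solver
    L = 6 ℕ.* ((17 ℕ.+ d) ℕ.* (16 ℕ.+ d))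
    expansion : 2 ℕ.* L ℕ.+ (16 ℕ.+ d) ℕ.* (6 ℕ.+ 17 ℕ.* d ℕ.+ d ℕ.* d) ≡
                2 ℕ.* (((16 ℕ.+ d) C 2) ℕ.* (14 ℕ.+ d))
    expansion = begin
      2 ℕ.* L ℕ.+ (16 ℕ.+ d) ℕ.* (6 ℕ.+ 17 ℕ.* d ℕ.+ d ℕ.* d)
        ≡⟨ solve 1 (λ d → con 2 :* (con 6 :* ((con 17 :+ d) :* (con 16 :+ d)))
                            :+ (con 16 :+ d) :* (con 6 :+ con 17 :* d :+ d :* d)
                          := ((con 16 :+ d) :* (con 15 :+ d)) :* (con 14 :+ d)) refl d ⟩
      ((16 ℕ.+ d) ℕ.* (15 ℕ.+ d)) ℕ.* (14 ℕ.+ d)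
        ≡⟨ cong (ℕ._* (14 ℕ.+ d)) (C[n,2]-double (15 ℕ.+ d)) ⟨
      (2 ℕ.* ((16 ℕ.+ d) C 2)) ℕ.* (14 ℕ.+ d)
        ≡⟨ ℕ.*-assoc 2 ((16 ℕ.+ d) C 2) (14 ℕ.+ d) ⟩
      2 ℕ.* (((16 ℕ.+ d) C 2) ℕ.* (14 ℕ.+ d))
        ∎
      where open ≡-Reasoning

twistedBernoulli-growth : ∀ n → 14 ℕ.≤ n →
  ℕtoℚ n < twistedBernoulli n → ℕtoℚ (2 ℕ.+ n) < twistedBernoulli (2 ℕ.+ n)
twistedBernoulli-growth n 14≤n n<Hn = ℚ.*-cancelˡ-<-nonNeg K {{ℕtoℚ-nonNeg (3 ℕ.+ n)}} (begin-strict
  K * ℕtoℚ (2 ℕ.+ n)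
    ≡⟨ ℚ.*-identityˡ (K * ℕtoℚ (2 ℕ.+ n)) ⟨
  (⅙ * ℕtoℚ 6) * (K * ℕtoℚ (2 ℕ.+ n))
    ≡⟨ ℚ.*-assoc ⅙ (ℕtoℚ 6) (K * ℕtoℚ (2 ℕ.+ n)) ⟩
  ⅙ * (ℕtoℚ 6 * (K * ℕtoℚ (2 ℕ.+ n)))
    ≡⟨ cong (⅙ *_) (trans (ℕtoℚ-homo-* 6 ((3 ℕ.+ n) ℕ.* (2 ℕ.+ n)))
                          (cong (ℕtoℚ 6 *_) (ℕtoℚ-homo-* (3 ℕ.+ n) (2 ℕ.+ n)))) ⟨
  ⅙ * ℕtoℚ (6 ℕ.* ((3 ℕ.+ n) ℕ.* (2 ℕ.+ n)))
    <⟨ ℚ.*-monoʳ-<-pos ⅙ (ℕtoℚ-mono-< (cubic-bound n 14≤n)) ⟩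
  ⅙ * ℕtoℚ (((2 ℕ.+ n) C 2) ℕ.* n)
    ≡⟨ cong (⅙ *_) (ℕtoℚ-homo-* ((2 ℕ.+ n) C 2) n) ⟩
  ⅙ * (A * ℕtoℚ n)
    ≡⟨ solve 3 (λ s a m → s :* (a :* m) := a :* (s :* m)) refl ⅙ A (ℕtoℚ n) ⟩
  A * (⅙ * ℕtoℚ n)
    ≤⟨ ℚ.*-monoˡ-≤-nonNeg A {{ℕtoℚ-nonNeg ((2 ℕ.+ n) C 2)}} (ℚ.*-monoˡ-≤-nonNeg ⅙ (ℚ.<⇒≤ n<Hn)) ⟩
  A * (⅙ * H n)
    ≡⟨⟩
  A * (H 2 * H n)
    ≤⟨ twistedBernoulli-lower-bound n ⟩
  K * H (2 ℕ.+ n)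
    ∎)
  where
  open ℚ.≤-Reasoning
  open +-*-Solver
  H = twistedBernoulli
  K = ℕtoℚ (3 ℕ.+ n)
  A = ℕtoℚ ((2 ℕ.+ n) C 2)
  ⅙ = ℤ.+ 1 / 6

-- Stated for variable n: a conversion check on bernoulli 20 itself would evaluate it through Defs.
twistedBernoulli-via-bernoulliVec′ : ∀ {n} → 2 ℕ.≤ n →
  twistedBernoulli n ≡ quarterSign n * lookup (bernoulliVec′ n) (fromℕ n)
twistedBernoulli-via-bernoulliVec′ {n} (s≤s (s≤s _)) = cong (quarterSign n *_) (bernoulli-via-bernoulliVec′ n)

twistedBernoulli-20 : ℕtoℚ 20 < twistedBernoulli 20
twistedBernoulli-20 = subst (ℕtoℚ 20 <_) (sym (twistedBernoulli-via-bernoulliVec′ {20} (ℕ.m≤m+n 2 18)))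
  (toWitness {a? = ℕtoℚ 20 ℚ.<? quarterSign 20 * lookup (bernoulliVec′ 20) (fromℕ 20)} tt)

twistedBernoulli-growth-by-4 : ∀ n → 14 ℕ.≤ n → ℕtoℚ n < twistedBernoulli n →
                               ∀ r → ℕtoℚ (r ℕ.* 4 ℕ.+ n) < twistedBernoulli (r ℕ.* 4 ℕ.+ n)
twistedBernoulli-growth-by-4 n 14≤n n<Hn zero    = n<Hn
twistedBernoulli-growth-by-4 n 14≤n n<Hn (suc r) =
  twistedBernoulli-growth (2 ℕ.+ m) (ℕ.≤-trans 14≤m (ℕ.m≤n+m m 2))
    (twistedBernoulli-growth m 14≤m (twistedBernoulli-growth-by-4 n 14≤n n<Hn r))
  where
  m = r ℕ.* 4 ℕ.+ n
  14≤m = ℕ.≤-trans 14≤n (ℕ.m≤n+m n (r ℕ.* 4))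

quarterSign-multiple-of-4 : ∀ q → quarterSign (q ℕ.* 4) ≡ - 1ℚ
quarterSign-multiple-of-4 zero    = refl
quarterSign-multiple-of-4 (suc q) = trans (-‿involutive (quarterSign (q ℕ.* 4))) (quarterSign-multiple-of-4 q)

bernoulli≥2-≡ : ∀ {n} → 2 ℕ.≤ n → bernoulli≥2 n ≡ bernoulli n
bernoulli≥2-≡ (s≤s (s≤s _)) = refl

bernoulli<-n : ∀ k → 20 ℕ.≤ k → 4 ∣ k → bernoulli k < - ℕtoℚ k
bernoulli<-n k 20≤k (divides q refl) = begin-strict
  bernoulli k                ≡⟨ -‿involutive (bernoulli k) ⟨
  - - bernoulli k            ≡⟨ cong -_ H≡-B ⟨
  - twistedBernoulli k       <⟨ ℚ.neg-antimono-< k<H ⟩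
  - ℕtoℚ k                   ∎
  where
  open ℚ.≤-Reasoning
  H≡-B : twistedBernoulli k ≡ - bernoulli k
  H≡-B = trans (cong₂ _*_ (quarterSign-multiple-of-4 q) (bernoulli≥2-≡ (ℕ.≤-trans (ℕ.m≤m+n 2 18) 20≤k)))
               (-1*x≈-x (bernoulli k))
  5≤q : 5 ℕ.≤ q
  5≤q = ℕ.*-cancelʳ-≤ 5 q 4 20≤k
  k<H : ℕtoℚ k < twistedBernoulli k
  k<H = subst (λ n → ℕtoℚ n < twistedBernoulli n)
              (trans (sym (ℕ.*-distribʳ-+ 4 (q ∸ 5) 5)) (cong (ℕ._* 4) (ℕ.m∸n+n≡m 5≤q)))
              (twistedBernoulli-growth-by-4 20 (ℕ.m≤m+n 14 6) twistedBernoulli-20 (q ∸ 5))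

parity-multiple-of-4 : ∀ q → parity (q ℕ.* 4) ≡ 0ℙ
parity-multiple-of-4 zero    = refl
parity-multiple-of-4 (suc q) = parity-multiple-of-4 q

parity-residue : ∀ r q → parity (r ℕ.+ q ℕ.* 4) ≡ parity r
parity-residue r q = trans (ℙ.+-homo-+ r (q ℕ.* 4))
                           (trans (cong (parity r ℙ.+_) (parity-multiple-of-4 q)) (ℙ.+-identityʳ (parity r)))

data Residue4 : ℕ → Set where
  4q+0 : ∀ q → Residue4 (q ℕ.* 4)
  4q+1 : ∀ q → Residue4 (1 ℕ.+ q ℕ.* 4)
  4q+2 : ∀ q → Residue4 (2 ℕ.+ q ℕ.* 4)
  4q+3 : ∀ q → Residue4 (3 ℕ.+ q ℕ.* 4)

residue4 : ∀ k → Residue4 k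
residue4 zero    = 4q+0 0
residue4 (suc k) with residue4 k
... | 4q+0 q = 4q+1 q
... | 4q+1 q = 4q+2 q
... | 4q+2 q = 4q+3 q
... | 4q+3 q = 4q+0 (suc q)

bernoulli-nonNeg : ∀ k → ¬ 4 ∣ k → 0ℚ ≤ bernoulli k
bernoulli-nonNeg k 4∤k with residue4 k
... | 4q+0 q = ⊥-elim (4∤k (divides q refl))
... | 4q+1 zero = toWitness {a? = 0ℚ ℚ.≤? _} tt
... | 4q+1 (suc q) = ℚ.≤-reflexive (sym (bernoulli≥2-odd (1 ℕ.+ suc q ℕ.* 4) (parity-residue 1 (suc q))))
... | 4q+2 q = subst (0ℚ ≤_) H≡B (twistedBernoulli-nonNeg k)
  where
  H≡B : twistedBernoulli k ≡ bernoulli k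
  H≡B = trans (cong (λ s → - s * bernoulli k) (quarterSign-multiple-of-4 q)) (ℚ.*-identityˡ (bernoulli k))
... | 4q+3 q = ℚ.≤-reflexive (sym (bernoulli≥2-odd (3 ℕ.+ q ℕ.* 4) (parity-residue 3 q)))

bernoulli+n-nonNeg-small-multiples-of-4 : ∀ q → q ℕ.< 5 → 0ℚ ≤ bernoulli (q ℕ.* 4) + ℕtoℚ (q ℕ.* 4)
bernoulli+n-nonNeg-small-multiples-of-4 q q<5 =
  subst (λ b → 0ℚ ≤ b + ℕtoℚ (q ℕ.* 4)) (sym (bernoulli-via-bernoulliVec′ (q ℕ.* 4))) (computed q q<5)
  where
  computed : ∀ q → q ℕ.< 5 →
             0ℚ ≤ lookup (bernoulliVec′ (q ℕ.* 4)) (fromℕ (q ℕ.* 4)) + ℕtoℚ (q ℕ.* 4)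
  computed 0 _ = toWitness {a? = 0ℚ ℚ.≤? _} tt
  computed 1 _ = toWitness {a? = 0ℚ ℚ.≤? _} tt
  computed 2 _ = toWitness {a? = 0ℚ ℚ.≤? _} tt
  computed 3 _ = toWitness {a? = 0ℚ ℚ.≤? _} tt
  computed 4 _ = toWitness {a? = 0ℚ ℚ.≤? _} tt
  computed (suc (suc (suc (suc (suc _))))) (s≤s (s≤s (s≤s (s≤s (s≤s ())))))

lemma2p1 : (k : ℕ) → ((bernoulli k + ℕtoℚ k) < 0ℚ) ⇔ ((20 ℕ.≤ k) × (4 ∣ k))
lemma2p1 k = mk⇔ forward backward
  where
  forward : bernoulli k + ℕtoℚ k < 0ℚ → 20 ℕ.≤ k × 4 ∣ k
  forward B+k<0 with 4 ∣? k
  ... | no 4∤k =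
    ⊥-elim (≤⇒≯ (ℚ.+-mono-≤ (bernoulli-nonNeg k 4∤k) (ℚ.nonNegative⁻¹ _ {{ℕtoℚ-nonNeg k}})) B+k<0)
  ... | yes 4∣k@(divides q refl) with 5 ℕ.≤? q
  ...   | yes 5≤q = ℕ.*-monoˡ-≤ 4 5≤q , 4∣k
  ...   | no 5≰q  = ⊥-elim (≤⇒≯ (bernoulli+n-nonNeg-small-multiples-of-4 q (ℕ.≰⇒> 5≰q)) B+k<0)
  backward : 20 ℕ.≤ k × 4 ∣ k → bernoulli k + ℕtoℚ k < 0ℚ
  backward (20≤k , 4∣k) = begin-strict
    bernoulli k + ℕtoℚ k      <⟨ ℚ.+-monoˡ-< (ℕtoℚ k) (bernoulli<-n k 20≤k 4∣k) ⟩
    - ℕtoℚ k + ℕtoℚ k         ≡⟨ ℚ.+-inverseˡ (ℕtoℚ k) ⟩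
    0ℚ                        ∎
    where open ℚ.≤-Reasoning
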